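{- Let $\mathcal{U}$ be a finite universe, $\mathcal{G}$ a finite family of subsets of $\mathcal{U}$ with a partial order $\preceq$, and $k>0$ an integer. Let $\mathcal{A}^*$ be an optimal solution to Bounded Max-Density Precedence-Closed Subfamily on $(\mathcal{U},\mathcal{G},\preceq,k)$ and let $\mathcal{A}$ be a $k$-greedy solution. Then $\Delta(\mathcal{A})\ge \Delta(\mathcal{A}^*)/k$.
   Context: A subfamily $\mathcal{A}\subseteq\mathcal{G}$ is precedence-closed if $x\in\mathcal{A}$ and $y\preceq x$ imply $y\in\mathcal{A}$. For $S\in\mathcal{G}$, $\overline{S}$ denotes the minimal precedence-closed subfamily of $\mathcal{G}$ containing $S$. $\mathrm{cov}(\mathcal{A})=\bigcup_{A\in\mathcal{A}}A$ and the density of a nonempty $\mathcal{A}$ is $\Delta(\mathcal{A})=|\mathrm{cov}(\mathcal{A})|/|\mathcal{A}|$. Bounded Max-Density Precedence-Closed Subfamily: find a precedence-closed $\mathcal{A}\subseteq\mathcal{G}$ with $|\mathcal{A}|\le k$ maximizing $\Delta(\mathcal{A})$. A $k$-greedy solution is a family $\overline{S}$, $S\in\mathcal{G}$ with $|\overline{S}|\le k$, maximizing $\Delta(\overline{S})$ among all such closures. -}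

module Defs where

open import Data.Nat using (ℕ; _*_; _≤_; _>_)
open import Data.Fin using (Fin)
open import Data.Fin.Subset using (Subset; _∈_; _⊆_; ∣_∣; ⋃; Nonempty)
open import Data.Fin.Subset.Properties using (_∈?_)
open import Data.List using (map; filter; allFin)
open import Data.Product using (_×_; ∃)
open import Relation.Binary.PropositionalEquality using (_≡_)
open import Relation.Binary.Structures using (IsPartialOrder)

-- An instance (U, G, ≼): universe U = Fin u, a finite family G of m subsets of U
-- (indexed by Fin m; members of G are identified with their indices), and a
-- partial order ≼ on the members of G.
record Instance (u m : ℕ) : Set₁ where
  field
    G       : Fin m → Subset u
    _≼_     : Fin m → Fin m → Set
    isPO    : IsPartialOrder _≡_ _≼_

module _ {u m : ℕ} (I : Instance u m) where
  open Instance I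

  PrecedenceClosed : Subset m → Set
  PrecedenceClosed A = ∀ x y → x ∈ A → y ≼ x → y ∈ A

  cov : Subset m → Subset u
  cov A = ⋃ (map G (filter (_∈? A) (allFin m)))

  IsClosure : Fin m → Subset m → Set
  IsClosure S C = PrecedenceClosed C × S ∈ C ×
                  (∀ B → PrecedenceClosed B → S ∈ B → C ⊆ B)

  -- Density comparisons, for nonempty A, B (so |A|, |B| > 0):
  --   Δ(A) ≤ Δ(B)    iff  |cov A| / |A| ≤ |cov B| / |B|
  --                  iff  |cov A| * |B| ≤ |cov B| * |A|
  DensityLe : Subset m → Subset m → Set
  DensityLe A B = ∣ cov A ∣ * ∣ B ∣ ≤ ∣ cov B ∣ * ∣ A ∣

  --   Δ(B)/k ≤ Δ(A)  iff  |cov B| / (k |B|) ≤ |cov A| / |A|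
  --                  iff  |cov B| * |A| ≤ |cov A| * (k * |B|)
  DensityDivLe : Subset m → ℕ → Subset m → Set
  DensityDivLe B k A = ∣ cov B ∣ * ∣ A ∣ ≤ ∣ cov A ∣ * (k * ∣ B ∣)

  -- Feasible solutions of Bounded Max-Density Precedence-Closed Subfamily
  -- (nonempty, so that the density is defined)
  Feasible : ℕ → Subset m → Set
  Feasible k A = PrecedenceClosed A × Nonempty A × ∣ A ∣ ≤ k

  Optimal : ℕ → Subset m → Set
  Optimal k A* = Feasible k A* × (∀ B → Feasible k B → DensityLe B A*)

  Greedy : ℕ → Subset m → Set
  Greedy k A = ∃ λ S → IsClosure S A × ∣ A ∣ ≤ k ×
    (∀ S' C' → IsClosure S' C' → ∣ C' ∣ ≤ k → DensityLe C' A)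

-- The closure of a single member x of a feasible family B stays inside B, so it
-- has at most k members and is a candidate of the greedy choice: hence
-- |G x| ≤ |cov ↓x| ≤ Δ(A) |↓x| ≤ Δ(A) k.  Summing over the at most |B| members of B
-- bounds |cov B| by |B| k Δ(A), i.e. Δ(A) ≥ Δ(B) / k.
module Submission where

open import Defs
open import Data.Bool using (true; false)
open import Data.Fin using (Fin; zero; suc)
open import Data.Fin.Properties using (sequence)
open import Data.Fin.Subset
  using (Subset; _∈_; _⊆_; ∣_∣; ⋃; _∪_; inside; outside)
open import Data.Fin.Subset.Properties
  using (_∈?_; p⊆q⇒∣p∣≤∣q∣; ∣⊥∣≡0; p⊆p∪q; q⊆p∪q)
open import Data.List using (List; []; _∷_; map; filter; allFin; length; tabulate)
open import Data.List.Properties using (length-map; map-tabulate)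
open import Data.List.Relation.Unary.All as All using (All; []; _∷_)
open import Data.List.Relation.Unary.All.Properties using (all-filter; map⁺)
open import Data.List.Relation.Unary.Any using (here; there)
import Data.List.Membership.Propositional as List
open import Data.List.Membership.Propositional.Properties
  using (∈-filter⁺; ∈-allFin; ∈-map⁺)
open import Data.Nat using (ℕ; suc; _+_; _*_; _≤_; _>_; _≤?_; z≤n; s≤s)
open import Data.Nat.Properties
open import Data.Product using (_,_; proj₂)
open import Data.Vec using ([]; _∷_)
import Data.Vec as Vec
open import Data.Vec.Properties using ([]=⇒lookup; lookup⇒[]=; lookup∘tabulate)
open import Effect.Monad using (RawMonad)
open import Function using (_∘_; id)
open import Level using (0ℓ)
open import Relation.Binary.PropositionalEquality using (_≡_; refl; sym; trans; cong; module ≡-Reasoning)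
open import Relation.Binary.Structures using (IsPartialOrder)
open import Relation.Nullary using (¬_; Dec; yes; does)
open import Relation.Nullary.Decidable using (dec-true; decidable-stable)
open import Relation.Nullary.Decidable.Core using (¬¬-excluded-middle)
open import Relation.Nullary.Negation using (¬¬-Monad; ¬¬-map)
open import Relation.Unary using (Pred; Decidable)

private
  variable
    n : ℕ

∣p∪q∣≤∣p∣+∣q∣ : (p q : Subset n) → ∣ p ∪ q ∣ ≤ ∣ p ∣ + ∣ q ∣
∣p∪q∣≤∣p∣+∣q∣ []             []            = z≤n
∣p∪q∣≤∣p∣+∣q∣ (inside ∷ p)  (inside ∷ q)  =
  s≤s (≤-trans (∣p∪q∣≤∣p∣+∣q∣ p q) (+-monoʳ-≤ ∣ p ∣ (n≤1+n ∣ q ∣)))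
∣p∪q∣≤∣p∣+∣q∣ (inside ∷ p)  (outside ∷ q) = s≤s (∣p∪q∣≤∣p∣+∣q∣ p q)
∣p∪q∣≤∣p∣+∣q∣ (outside ∷ p) (inside ∷ q)  =
  ≤-trans (s≤s (∣p∪q∣≤∣p∣+∣q∣ p q)) (≤-reflexive (sym (+-suc ∣ p ∣ ∣ q ∣)))
∣p∪q∣≤∣p∣+∣q∣ (outside ∷ p) (outside ∷ q) = ∣p∪q∣≤∣p∣+∣q∣ p q

∣⋃ps∣*a≤length[ps]*c : ∀ {a c} (ps : List (Subset n)) →
  All (λ p → ∣ p ∣ * a ≤ c) ps → ∣ ⋃ ps ∣ * a ≤ length ps * c
∣⋃ps∣*a≤length[ps]*c {n} {a} []       []               = ≤-reflexive (cong (_* a) (∣⊥∣≡0 n))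
∣⋃ps∣*a≤length[ps]*c {a = a} {c} (p ∷ ps) (pa≤c ∷ psa≤c) = begin
  ∣ p ∪ ⋃ ps ∣ * a           ≤⟨ *-monoˡ-≤ a (∣p∪q∣≤∣p∣+∣q∣ p (⋃ ps)) ⟩
  (∣ p ∣ + ∣ ⋃ ps ∣) * a     ≡⟨ *-distribʳ-+ a ∣ p ∣ ∣ ⋃ ps ∣ ⟩
  ∣ p ∣ * a + ∣ ⋃ ps ∣ * a   ≤⟨ +-mono-≤ pa≤c (∣⋃ps∣*a≤length[ps]*c ps psa≤c) ⟩
  c + length ps * c          ∎
  where open ≤-Reasoning

⊆-⋃ : ∀ {p} {ps : List (Subset n)} → p List.∈ ps → p ⊆ ⋃ ps
⊆-⋃ {ps = p ∷ ps} (here refl) = p⊆p∪q (⋃ ps)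
⊆-⋃ {ps = q ∷ ps} (there p∈ps) = q⊆p∪q q (⋃ ps) ∘ ⊆-⋃ p∈ps

members : Subset n → List (Fin n)
members {n} p = filter (_∈? p) (allFin n)

filter-∈?-map-suc : ∀ b (p : Subset n) (xs : List (Fin n)) →
  filter (_∈? (b ∷ p)) (map suc xs) ≡ map suc (filter (_∈? p) xs)
filter-∈?-map-suc b p []       = refl
filter-∈?-map-suc b p (x ∷ xs) with does (x ∈? p)
... | true  = cong (suc x ∷_) (filter-∈?-map-suc b p xs)
... | false = filter-∈?-map-suc b p xs

filter-∈?-tabulate-suc : ∀ b (p : Subset n) →
  filter (_∈? (b ∷ p)) (tabulate suc) ≡ map suc (members p)
filter-∈?-tabulate-suc {n} b p = begin
  filter (_∈? (b ∷ p)) (tabulate suc)         ≡⟨ cong (filter (_∈? (b ∷ p))) (sym (map-tabulate id suc)) ⟩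
  filter (_∈? (b ∷ p)) (map suc (allFin n))   ≡⟨ filter-∈?-map-suc b p (allFin n) ⟩
  map suc (members p)                         ∎
  where open ≡-Reasoning

length-members : (p : Subset n) → length (members p) ≡ ∣ p ∣
length-members-tail : ∀ b (p : Subset n) → length (filter (_∈? (b ∷ p)) (tabulate suc)) ≡ ∣ p ∣

length-members []            = refl
length-members (inside ∷ p)  = cong suc (length-members-tail inside p)
length-members (outside ∷ p) = length-members-tail outside p

length-members-tail b p = begin
  length (filter (_∈? (b ∷ p)) (tabulate suc))  ≡⟨ cong length (filter-∈?-tabulate-suc b p) ⟩
  length (map suc (members p))                  ≡⟨ length-map suc (members p) ⟩
  length (members p)                            ≡⟨ length-members p ⟩
  ∣ p ∣                                         ∎
  where open ≡-Reasoning

∈-members : ∀ {x} {p : Subset n} → x ∈ p → x List.∈ members p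
∈-members {x = x} {p} x∈p = ∈-filter⁺ (_∈? p) (∈-allFin x) x∈p

module _ {P : Pred (Fin n) 0ℓ} (P? : Decidable P) where

  fromDecidable : Subset n
  fromDecidable = Vec.tabulate (does ∘ P?)

  ∈-fromDecidable⁺ : ∀ {x} → P x → x ∈ fromDecidable
  ∈-fromDecidable⁺ {x} px =
    lookup⇒[]= x fromDecidable (trans (lookup∘tabulate (does ∘ P?) x) (dec-true (P? x) px))

  ∈-fromDecidable⁻ : ∀ {x} → x ∈ fromDecidable → P x
  ∈-fromDecidable⁻ {x} x∈ = witness (P? x) (trans (sym (lookup∘tabulate (does ∘ P?) x)) ([]=⇒lookup x∈))
    where
    witness : (a? : Dec (P x)) → does a? ≡ true → P x
    witness (yes px) _ = px

¬¬-decidable : ∀ {m} (R : Fin m → Fin n → Set) → ¬ ¬ (∀ x y → Dec (R x y))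
¬¬-decidable R = sequence′ (λ _ → sequence′ (λ _ → ¬¬-excluded-middle))
  where sequence′ = sequence (RawMonad.rawApplicative ¬¬-Monad)

module _ {u m} (I : Instance u m) where
  open Instance I
  private module ≼ = IsPartialOrder isPO

  G⊆cov : ∀ {x A} → x ∈ A → G x ⊆ cov I A
  G⊆cov {A = A} x∈A = ⊆-⋃ (∈-map⁺ G (∈-members x∈A))

  ∣cov[A]∣*a≤∣A∣*c : ∀ {A a c} → (∀ {x} → x ∈ A → ∣ G x ∣ * a ≤ c) → ∣ cov I A ∣ * a ≤ ∣ A ∣ * c
  ∣cov[A]∣*a≤∣A∣*c {A} {a} {c} bound = begin
    ∣ cov I A ∣ * a
      ≤⟨ ∣⋃ps∣*a≤length[ps]*c (map G (members A)) (map⁺ (All.map bound (all-filter (_∈? A) (allFin m)))) ⟩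
    length (map G (members A)) * c
      ≡⟨ cong (_* c) (trans (length-map G (members A)) (length-members A)) ⟩
    ∣ A ∣ * c
      ∎
    where open ≤-Reasoning

  module _ (≼? : ∀ x y → Dec (y ≼ x)) where

    ↓ : Fin m → Subset m
    ↓ x = fromDecidable (≼? x)

    ↓-isClosure : ∀ x → IsClosure I x (↓ x)
    ↓-isClosure x =
        (λ y z y∈↓x z≼y → ∈-fromDecidable⁺ (≼? x) (≼.trans z≼y (∈-fromDecidable⁻ (≼? x) y∈↓x)))
      , ∈-fromDecidable⁺ (≼? x) ≼.refl
      , (λ B closed x∈B y∈↓x → closed x _ x∈B (∈-fromDecidable⁻ (≼? x) y∈↓x))

    ↓⊆ : ∀ {x B} → PrecedenceClosed I B → x ∈ B → ↓ x ⊆ B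
    ↓⊆ {x} {B} closed x∈B = proj₂ (proj₂ (↓-isClosure x)) B closed x∈B

    ∣Gx∣*∣A∣≤∣cov[A]∣*k : ∀ {k A B x} → Greedy I k A → Feasible I k B → x ∈ B →
      ∣ G x ∣ * ∣ A ∣ ≤ ∣ cov I A ∣ * k
    ∣Gx∣*∣A∣≤∣cov[A]∣*k {k} {A} {B} {x} (_ , _ , _ , greedy) (closed , _ , ∣B∣≤k) x∈B = begin
      ∣ G x ∣ * ∣ A ∣          ≤⟨ *-monoˡ-≤ ∣ A ∣ (p⊆q⇒∣p∣≤∣q∣ (G⊆cov (∈-fromDecidable⁺ (≼? x) ≼.refl))) ⟩
      ∣ cov I (↓ x) ∣ * ∣ A ∣  ≤⟨ greedy x (↓ x) (↓-isClosure x) ∣↓x∣≤k ⟩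
      ∣ cov I A ∣ * ∣ ↓ x ∣    ≤⟨ *-monoʳ-≤ (∣ cov I A ∣) ∣↓x∣≤k ⟩
      ∣ cov I A ∣ * k          ∎
      where
      open ≤-Reasoning
      ∣↓x∣≤k : ∣ ↓ x ∣ ≤ k
      ∣↓x∣≤k = ≤-trans (p⊆q⇒∣p∣≤∣q∣ (↓⊆ closed x∈B)) ∣B∣≤k

    greedy-approximation : ∀ {k A B} → Feasible I k B → Greedy I k A → DensityDivLe I B k A
    greedy-approximation {k} {A} {B} feasible greedy = begin
      ∣ cov I B ∣ * ∣ A ∣      ≤⟨ ∣cov[A]∣*a≤∣A∣*c (∣Gx∣*∣A∣≤∣cov[A]∣*k greedy feasible) ⟩
      ∣ B ∣ * (∣ cov I A ∣ * k) ≡⟨ *-comm ∣ B ∣ _ ⟩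
      (∣ cov I A ∣ * k) * ∣ B ∣ ≡⟨ *-assoc (∣ cov I A ∣) k (∣ B ∣) ⟩
      ∣ cov I A ∣ * (k * ∣ B ∣) ∎
      where open ≤-Reasoning

-- ≼ need not be decidable, but the conclusion is a decidable inequality, so it
-- suffices that ≼ is decidable up to double negation.
theorem11 : ∀ {u m} (I : Instance u m) (k : ℕ) → k > 0 →
    (A* A : Subset m) → Optimal I k A* → Greedy I k A →
    DensityDivLe I A* k A
theorem11 I k _ A* A (feasible , _) greedy =
  decidable-stable (_ ≤? _)
    (¬¬-map (λ ≼? → greedy-approximation I ≼? feasible greedy)
            (¬¬-decidable (λ x y → Instance._≼_ I y x)))
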